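{- For all cyclic formulas $\psi_0,\dots,\psi_{n-1},\chi_0,\dots,\chi_{m-1},\phi$: if $\bigwedge_{i<n}\Box^\bullet\psi_i,\ \bigwedge_{j<m}\boxdot^\bullet\chi_j\vdash_{\mathsf{CHL}}\Box\phi\to\phi$, then $\bigwedge_{i<n}\Box^\bullet\psi_i,\ \bigwedge_{j<m}\boxdot^\bullet\chi_j\vdash_{\mathsf{CHL}}\phi$.
   Context: Labels: $\bot,\top$ and propositional variables (arity 0), $\neg,\Box$ (arity 1), $\wedge,\vee,\to$ (arity 2). A graph is $\langle V,r,S,\lambda\rangle$ with $V$ finite, root $r$, labelling $\lambda$, $S:V\to V^{*}$ ordered successors (length = arity of label); every vertex reachable from $r$. A (cyclic) formula is a graph in which every cycle (closed path of pairwise distinct vertices along successors) contains a $\Box$-labelled vertex. Bisimulation: $aRa'$ implies equal labels and $i$-th successors related; $\simeq$ = bisimilarity relating roots. $\phi$ modalised in $p$: every path from root to a $p$-labelled vertex contains a $\Box$-labelled vertex; then $\digamma p.\phi$ identifies the root with all $p$-labelled vertices (keeping the root's label). $\mathsf{CHL}$: least set of cyclic formulas containing all substitution instances of propositional tautologies, all $\Box(\phi\to\psi)\to(\Box\phi\to\Box\psi)$, all $\phi\leftrightarrow\psi$ with $\phi\simeq\psi$, closed under modus ponens, necessitation and Löb's rule (from $\vdash\Box\phi\to\phi$ infer $\vdash\phi$). $\Gamma\vdash_{\mathsf{CHL}}\phi$ means $\mathsf{CHL}\vdash\bigwedge\Gamma\to\phi$. $\Box^\bullet\phi:=\digamma p.\Box(\phi\wedge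 p)$ ($p$ not in $\phi$); $\boxdot^\bullet\phi:=\phi\wedge\Box^\bullet\phi$. -}

module Defs where

open import Data.Nat using (ℕ; zero; suc; _+_; _⊔_; _≡ᵇ_)
open import Data.Fin using (Fin; zero; suc; splitAt; _↑ˡ_; _↑ʳ_)
open import Data.Vec using (Vec; []; _∷_)
import Data.Vec as Vec
open import Data.Vec.Membership.Propositional using () renaming (_∈_ to _∈ᵛ_)
open import Data.Vec.Relation.Binary.Pointwise.Inductive using (Pointwise)
open import Data.List using (List; []; _∷_; _++_; foldr; allFin)
import Data.List as List
open import Data.List.Relation.Unary.Any using (Any)
open import Data.List.Relation.Unary.Unique.Propositional using (Unique)
open import Data.Bool using (Bool; true; false; if_then_else_; not; _∧_; _∨_)
open import Data.Sum using (_⊎_; inj₁; inj₂)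
open import Data.Product using (Σ; _×_; ∃)
open import Relation.Binary.PropositionalEquality using (_≡_)

data Label : Set where
  ⊥ᴸ ⊤ᴸ : Label
  varᴸ  : ℕ → Label
  ¬ᴸ □ᴸ : Label
  ∧ᴸ ∨ᴸ →ᴸ : Label

arity : Label → ℕ
arity ⊥ᴸ = 0
arity ⊤ᴸ = 0
arity (varᴸ _) = 0
arity ¬ᴸ = 1
arity □ᴸ = 1
arity ∧ᴸ = 2
arity ∨ᴸ = 2
arity →ᴸ = 2

-- Graphs ⟨V, r, S, λ⟩ with V = Fin size.
-- Vertices not reachable from the root are allowed but semantically
-- irrelevant: a Graph represents its part reachable from the root
--.

record Graph : Set where
  constructor graph
  field
    size  : ℕ
    label : Fin size → Label
    succ  : (v : Fin size) → Vec (Fin size) (arity (label v))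
    root  : Fin size
open Graph public

module _ (g : Graph) where
  Edge : Fin (size g) → Fin (size g) → Set
  Edge v w = w ∈ᵛ succ g v

  data Reach : Fin (size g) → Set where
    reach-root : Reach (root g)
    reach-step : ∀ {v w} → Reach v → Edge v w → Reach w

  data Walk : Fin (size g) → Fin (size g) → List (Fin (size g)) → Set where
    here  : ∀ {v} → Walk v v (v ∷ [])
    there : ∀ {v w t vs} → Edge v w → Walk w t vs → Walk v t (v ∷ vs)

  IsBox : Fin (size g) → Set
  IsBox v = label g v ≡ □ᴸ

  IsCyclicFormula : Set
  IsCyclicFormula = ∀ {v t vs} → Reach v → Walk v t vs → Edge t v → Unique vs
                    → Any IsBox vs

  Modalised : ℕ → Set
  Modalised p = ∀ {t vs} → Walk (root g) t vs → label g t ≡ varᴸ p → Any IsBox vs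

record Formula : Set where
  constructor formula
  field
    gr        : Graph
    isFormula : IsCyclicFormula gr
open Formula public

IsBisimulation : (g h : Graph) → (Fin (size g) → Fin (size h) → Set) → Set
IsBisimulation g h R = ∀ {a a'} → R a a' →
  (label g a ≡ label h a') × Pointwise R (succ g a) (succ h a')

_≃_ : Graph → Graph → Set₁
g ≃ h = Σ (Fin (size g) → Fin (size h) → Set) λ R →
  IsBisimulation g h R × R (root g) (root h)

⊥ᵍ ⊤ᵍ : Graph
⊥ᵍ = graph 1 (λ _ → ⊥ᴸ) (λ _ → []) zero
⊤ᵍ = graph 1 (λ _ → ⊤ᴸ) (λ _ → []) zero

varᵍ : ℕ → Graph
varᵍ p = graph 1 (λ _ → varᴸ p) (λ _ → []) zero

data UnOp : Set where
  negOp boxOp : UnOp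

unL : UnOp → Label
unL negOp = ¬ᴸ
unL boxOp = □ᴸ

unSucc : ∀ {k} (u : UnOp) → Fin k → Vec (Fin k) (arity (unL u))
unSucc negOp x = x ∷ []
unSucc boxOp x = x ∷ []

unᵍ : UnOp → Graph → Graph
unᵍ u g = graph (suc (size g)) lab sc zero
  where
  lab : Fin (suc (size g)) → Label
  lab zero = unL u
  lab (suc v) = label g v
  sc : (v : Fin (suc (size g))) → Vec (Fin (suc (size g))) (arity (lab v))
  sc zero = unSucc u (suc (root g))
  sc (suc v) = Vec.map suc (succ g v)

data BinOp : Set where
  andOp orOp impOp : BinOp

binL : BinOp → Label
binL andOp = ∧ᴸ
binL orOp = ∨ᴸ
binL impOp = →ᴸ

binSucc : ∀ {k} (b : BinOp) → Fin k → Fin k → Vec (Fin k) (arity (binL b))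
binSucc andOp x y = x ∷ y ∷ []
binSucc orOp x y = x ∷ y ∷ []
binSucc impOp x y = x ∷ y ∷ []

binᵍ : BinOp → Graph → Graph → Graph
binᵍ b g h = graph (suc (m + n)) lab sc zero
  where
  m = size g
  n = size h
  labS : Fin m ⊎ Fin n → Label
  labS (inj₁ a) = label g a
  labS (inj₂ c) = label h c
  lab : Fin (suc (m + n)) → Label
  lab zero = binL b
  lab (suc v) = labS (splitAt m v)
  scS : (s : Fin m ⊎ Fin n) → Vec (Fin (suc (m + n))) (arity (labS s))
  scS (inj₁ a) = Vec.map (λ x → suc (x ↑ˡ n)) (succ g a)
  scS (inj₂ c) = Vec.map (λ x → suc (m ↑ʳ x)) (succ h c)
  sc : (v : Fin (suc (m + n))) → Vec (Fin (suc (m + n))) (arity (lab v))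
  sc zero = binSucc b (suc (root g ↑ˡ n)) (suc (m ↑ʳ root h))
  sc (suc v) = scS (splitAt m v)

¬ᵍ_ □ᵍ_ : Graph → Graph
¬ᵍ_ = unᵍ negOp
□ᵍ_ = unᵍ boxOp

_∧ᵍ_ _∨ᵍ_ _⇒ᵍ_ _⇔ᵍ_ : Graph → Graph → Graph
_∧ᵍ_ = binᵍ andOp
_∨ᵍ_ = binᵍ orOp
_⇒ᵍ_ = binᵍ impOp
φ ⇔ᵍ ψ = (φ ⇒ᵍ ψ) ∧ᵍ (ψ ⇒ᵍ φ)

infix 30 ¬ᵍ_ □ᵍ_ □•_ ⊡•_
infixr 25 _∧ᵍ_
infixr 24 _∨ᵍ_
infixr 23 _⇒ᵍ_
infix 22 _⇔ᵍ_

-- ϝ p. φ : identify the root with all p-labelled vertices (keeping the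
-- root's label), realised by redirecting every edge into a p-labelled
-- vertex to the root (the p-labelled vertices become unreachable).
isVar : ℕ → Label → Bool
isVar p (varᴸ q) = q ≡ᵇ p
isVar p _ = false

ϝ : ℕ → Graph → Graph
ϝ p g = graph (size g) (label g) sc (root g)
  where
  redirect : Fin (size g) → Fin (size g)
  redirect w = if isVar p (label g w) then root g else w
  sc : (v : Fin (size g)) → Vec (Fin (size g)) (arity (label g v))
  sc v = Vec.map redirect (succ g v)

varIdx : Label → ℕ
varIdx (varᴸ q) = q
varIdx _ = 0

fresh : Graph → ℕ
fresh g = suc (foldr _⊔_ 0 (List.map (λ v → varIdx (label g v)) (allFin (size g))))

□•_ : Graph → Graph
□• φ = ϝ (fresh φ) (□ᵍ (φ ∧ᵍ varᵍ (fresh φ)))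

⊡•_ : Graph → Graph
⊡• φ = φ ∧ᵍ □• φ

data PForm : Set where
  pvar : ℕ → PForm
  p⊥ p⊤ : PForm
  p¬ : PForm → PForm
  p∧ p∨ p⇒ : PForm → PForm → PForm

eval : (ℕ → Bool) → PForm → Bool
eval v (pvar i) = v i
eval v p⊥ = false
eval v p⊤ = true
eval v (p¬ A) = not (eval v A)
eval v (p∧ A B) = eval v A ∧ eval v B
eval v (p∨ A B) = eval v A ∨ eval v B
eval v (p⇒ A B) = not (eval v A) ∨ eval v B

Tautology : PForm → Set
Tautology A = ∀ (v : ℕ → Bool) → eval v A ≡ true

inst : (ℕ → Graph) → PForm → Graph
inst σ (pvar i) = σ i
inst σ p⊥ = ⊥ᵍ
inst σ p⊤ = ⊤ᵍ
inst σ (p¬ A) = ¬ᵍ inst σ A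
inst σ (p∧ A B) = inst σ A ∧ᵍ inst σ B
inst σ (p∨ A B) = inst σ A ∨ᵍ inst σ B
inst σ (p⇒ A B) = inst σ A ⇒ᵍ inst σ B

data CHL⊢_ : Graph → Set₁ where
  taut : (A : PForm) → Tautology A → (σ : ℕ → Formula) →
         CHL⊢ inst (λ i → gr (σ i)) A
  axK  : (φ ψ : Formula) →
         CHL⊢ (□ᵍ (gr φ ⇒ᵍ gr ψ) ⇒ᵍ (□ᵍ gr φ ⇒ᵍ □ᵍ gr ψ))
  bisim : (φ ψ : Formula) → gr φ ≃ gr ψ → CHL⊢ (gr φ ⇔ᵍ gr ψ)
  mp   : ∀ {φ ψ} → CHL⊢ φ → CHL⊢ (φ ⇒ᵍ ψ) → CHL⊢ ψ
  nec  : ∀ {φ} → CHL⊢ φ → CHL⊢ (□ᵍ φ)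
  löb  : ∀ {φ} → CHL⊢ (□ᵍ φ ⇒ᵍ φ) → CHL⊢ φ

infix 10 CHL⊢_ _⊢_

⋀ : List Graph → Graph
⋀ [] = ⊤ᵍ
⋀ (φ ∷ Γ) = φ ∧ᵍ ⋀ Γ

_⊢_ : List Graph → Graph → Set₁
Γ ⊢ φ = CHL⊢ (⋀ Γ ⇒ᵍ φ)

ctx : ∀ {n m} → (Fin n → Formula) → (Fin m → Formula) → List Graph
ctx ψ χ = List.tabulate (λ i → □• gr (ψ i)) ++ List.tabulate (λ j → ⊡• gr (χ j))

-- The context G := ⋀ᵢ □•ψᵢ ∧ ⋀ⱼ ⊡•χⱼ is persistent, ⊢ G → □G: the fixpoint
-- □•ψ is bisimilar to its unfolding □(ψ ∧ □•ψ), so □•ψ → □□•ψ and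
-- ⊡•χ → □⊡•χ, and persistence is preserved by conjunction. For a persistent
-- G, the hypothesis G ⊢ □φ → φ together with axiom K yields
-- ⊢ □(G → φ) → (G → φ), and Löb's rule gives ⊢ G → φ.
module Submission where

open import Defs
open import Data.Bool using (Bool; true; false; if_then_else_; not; _∧_; _∨_)
import Data.Bool.Properties as Bool
open import Data.Empty using (⊥-elim)
open import Data.Fin using (Fin; zero; suc; splitAt; _↑ˡ_; _↑ʳ_)
open import Data.Fin.Properties using (suc-injective; ↑ˡ-injective; ↑ʳ-injective; splitAt-↑ˡ; splitAt-↑ʳ)
open import Data.List using (List; []; _∷_; _++_; foldr)
import Data.List as List
open import Data.List.Properties using (map-++; map-tabulate)
open import Data.List.Membership.Propositional using () renaming (_∈_ to _∈ˡ_)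
open import Data.List.Membership.Propositional.Properties using (∈-map⁺; ∈-++⁺ˡ; ∈-++⁺ʳ; ∈-allFin)
open import Data.List.Relation.Unary.All using (All; []; _∷_)
import Data.List.Relation.Unary.All as All
import Data.List.Relation.Unary.All.Properties as All
open import Data.List.Relation.Unary.Any using (Any; here; there)
import Data.List.Relation.Unary.Any as Any
import Data.List.Relation.Unary.Any.Properties as Any
open import Data.List.Relation.Unary.Unique.Propositional using (Unique)
import Data.List.Relation.Unary.Unique.Propositional.Properties as Unique
open import Data.Nat using (ℕ; zero; suc; _⊔_; _≡ᵇ_; _≤_; _<_; s≤s)
open import Data.Nat.Properties using (≤-refl; ≡⇒≡ᵇ; m≤m⊔n; m≤n⇒m≤o⊔n; m<n⇒m<n⊔o; m<n⇒m<o⊔n)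
open import Data.Product using (∃; ∃₂; _×_; _,_)
open import Data.Sum using (_⊎_; inj₁; inj₂; [_,_]′)
open import Data.Vec using (Vec; []; _∷_)
import Data.Vec as Vec
open import Data.Vec.Membership.Propositional using () renaming (_∈_ to _∈ᵛ_)
open import Data.Vec.Membership.Propositional.Properties using (fromAny)
import Data.Vec.Relation.Unary.Any as VecAny
import Data.Vec.Relation.Unary.Any.Properties as VecAny
open import Data.Vec.Relation.Binary.Pointwise.Inductive using (Pointwise; []; _∷_)
open import Function using (_∘_; id; Equivalence)
open import Relation.Nullary using (¬_; Dec)
open import Relation.Nullary.Decidable using (True; toWitness)
open import Relation.Binary.PropositionalEquality
  using (_≡_; refl; sym; trans; cong; cong₂; subst; module ≡-Reasoning)

-- Deciding tautologies by truth tables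

bound : PForm → ℕ
bound (pvar i) = suc i
bound p⊥ = 0
bound p⊤ = 0
bound (p¬ A) = bound A
bound (p∧ A B) = bound A ⊔ bound B
bound (p∨ A B) = bound A ⊔ bound B
bound (p⇒ A B) = bound A ⊔ bound B

eval-cong : ∀ A {v w : ℕ → Bool} → (∀ {i} → i < bound A → v i ≡ w i) →
            eval v A ≡ eval w A
eval-cong (pvar i) v≗w = v≗w ≤-refl
eval-cong p⊥ _ = refl
eval-cong p⊤ _ = refl
eval-cong (p¬ A) v≗w = cong not (eval-cong A v≗w)
eval-cong (p∧ A B) v≗w =
  cong₂ _∧_ (eval-cong A (v≗w ∘ m<n⇒m<n⊔o _)) (eval-cong B (v≗w ∘ m<n⇒m<o⊔n _))
eval-cong (p∨ A B) v≗w =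
  cong₂ _∨_ (eval-cong A (v≗w ∘ m<n⇒m<n⊔o _)) (eval-cong B (v≗w ∘ m<n⇒m<o⊔n _))
eval-cong (p⇒ A B) v≗w =
  cong₂ (λ a b → not a ∨ b) (eval-cong A (v≗w ∘ m<n⇒m<n⊔o _)) (eval-cong B (v≗w ∘ m<n⇒m<o⊔n _))

valuation : List Bool → ℕ → Bool
valuation [] _ = false
valuation (b ∷ bs) zero = b
valuation (b ∷ bs) (suc i) = valuation bs i

prefix : ℕ → (ℕ → Bool) → List Bool
prefix zero v = []
prefix (suc k) v = v zero ∷ prefix k (v ∘ suc)

valuation-prefix : ∀ k v {i} → i < k → valuation (prefix k v) i ≡ v i
valuation-prefix (suc k) v {zero} _ = refl
valuation-prefix (suc k) v {suc i} (s≤s i<k) = valuation-prefix k (v ∘ suc) i<k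

allBitStrings : ℕ → List (List Bool)
allBitStrings zero = [] ∷ []
allBitStrings (suc k) = List.map (true ∷_) (allBitStrings k) ++ List.map (false ∷_) (allBitStrings k)

prefix∈allBitStrings : ∀ k v → prefix k v ∈ˡ allBitStrings k
prefix∈allBitStrings zero v = here refl
prefix∈allBitStrings (suc k) v with v zero
... | true = ∈-++⁺ˡ (∈-map⁺ (true ∷_) (prefix∈allBitStrings k (v ∘ suc)))
... | false = ∈-++⁺ʳ _ (∈-map⁺ (false ∷_) (prefix∈allBitStrings k (v ∘ suc)))

TruthTable : PForm → Set
TruthTable A = All (λ bs → eval (valuation bs) A ≡ true) (allBitStrings (bound A))

truthTable? : ∀ A → Dec (TruthTable A)
truthTable? A = All.all? (λ bs → eval (valuation bs) A Bool.≟ true) (allBitStrings (bound A))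

truthTable⇒tautology : ∀ A → TruthTable A → Tautology A
truthTable⇒tautology A rows v = begin
  eval v A                               ≡⟨ eval-cong A (sym ∘ valuation-prefix (bound A) v) ⟩
  eval (valuation (prefix (bound A) v)) A ≡⟨ All.lookup rows (prefix∈allBitStrings (bound A) v) ⟩
  true                                   ∎
  where open ≡-Reasoning

-- Graph embeddings reflect cycles

∈ᵛ-map⁻ : ∀ {A B : Set} {k} (f : A → B) {xs : Vec A k} {y} →
          y ∈ᵛ Vec.map f xs → ∃ λ x → x ∈ᵛ xs × y ≡ f x
∈ᵛ-map⁻ f y∈ = fromAny (VecAny.map⁻ y∈)

walk-start : ∀ {g v t vs} {P : Fin (size g) → Set} → Walk g v t vs → P v → Any P vs
walk-start here pv = here pv
walk-start (there _ _) pv = here pv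

record Embedding (g G : Graph) : Set where
  field
    ι         : Fin (size g) → Fin (size G)
    injective : ∀ {a b} → ι a ≡ ι b → a ≡ b
    label-ι   : ∀ a → label G (ι a) ≡ label g a
    edge-ι⁻   : ∀ {a w} → Edge G (ι a) w → ∃ λ b → w ≡ ι b × Edge g a b

  walk-ι⁻ : ∀ {a t vs} → Walk G (ι a) t vs →
            ∃₂ λ t′ vs′ → Walk g a t′ vs′ × t ≡ ι t′ × vs ≡ List.map ι vs′
  walk-ι⁻ {a} here = a , a ∷ [] , here , refl , refl
  walk-ι⁻ (there ed rest) with edge-ι⁻ ed
  ... | b , refl , ed′ with walk-ι⁻ rest
  ... | t′ , vs′ , rest′ , refl , refl = t′ , _ , there ed′ rest′ , refl , refl

  cycle-ι⁻ : IsCyclicFormula g → ∀ {a t vs} → Reach g a → Walk G (ι a) t vs →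
             Edge G t (ι a) → Unique vs → Any (IsBox G) vs
  cycle-ι⁻ cyclic ra walk back unique with walk-ι⁻ walk
  ... | t′ , vs′ , walk′ , refl , refl with edge-ι⁻ back
  ... | b , ιa≡ιb , back′ with injective ιa≡ιb
  ... | refl = Any.map⁺ (Any.map (λ {x} → trans (label-ι x))
                                 (cyclic ra walk′ back′ (Unique.map⁻ unique)))

open Embedding

_∘ᴱ_ : ∀ {g h G : Graph} → Embedding h G → Embedding g h → Embedding g G
_∘ᴱ_ {g} {G = G} E F = record
  { ι = ι E ∘ ι F
  ; injective = injective F ∘ injective E
  ; label-ι = λ a → trans (label-ι E (ι F a)) (label-ι F a)
  ; edge-ι⁻ = edge
  }
  where
  edge : ∀ {a w} → Edge G (ι E (ι F a)) w → ∃ λ b → w ≡ ι E (ι F b) × Edge g a b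
  edge {a} ed with edge-ι⁻ E {ι F a} ed
  ... | _ , refl , ed′ with edge-ι⁻ F ed′
  ... | b , refl , ed″ = b , refl , ed″

-- Cyclic formulas are closed under the connectives

unSucc-∈ : ∀ u {k} {x w : Fin k} → w ∈ᵛ unSucc u x → w ≡ x
unSucc-∈ negOp (VecAny.here refl) = refl
unSucc-∈ boxOp (VecAny.here refl) = refl

binSucc-∈ : ∀ b {k} {x y w : Fin k} → w ∈ᵛ binSucc b x y → w ≡ x ⊎ w ≡ y
binSucc-∈ andOp (VecAny.here refl) = inj₁ refl
binSucc-∈ andOp (VecAny.there (VecAny.here refl)) = inj₂ refl
binSucc-∈ orOp (VecAny.here refl) = inj₁ refl
binSucc-∈ orOp (VecAny.there (VecAny.here refl)) = inj₂ refl
binSucc-∈ impOp (VecAny.here refl) = inj₁ refl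
binSucc-∈ impOp (VecAny.there (VecAny.here refl)) = inj₂ refl

⊤ᵍ-isCyclic : IsCyclicFormula ⊤ᵍ
⊤ᵍ-isCyclic _ _ () _

module _ (u : UnOp) (g : Graph) where

  unᵍ-embedding : Embedding g (unᵍ u g)
  unᵍ-embedding = record
    { ι = suc ; injective = suc-injective ; label-ι = λ _ → refl ; edge-ι⁻ = edge }
    where
    edge : ∀ {a w} → Edge (unᵍ u g) (suc a) w → ∃ λ b → w ≡ suc b × Edge g a b
    edge ed with ∈ᵛ-map⁻ suc ed
    ... | b , ed′ , refl = b , refl , ed′

  unᵍ-root-source : ∀ {t} → ¬ Edge (unᵍ u g) t zero
  unᵍ-root-source {zero} ed with unSucc-∈ u ed
  ... | ()
  unᵍ-root-source {suc t} ed with ∈ᵛ-map⁻ suc ed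
  ... | _ , _ , ()

  unᵍ-reach : ∀ {v} → Reach (unᵍ u g) v → v ≡ zero ⊎ ∃ λ a → v ≡ suc a × Reach g a
  unᵍ-reach reach-root = inj₁ refl
  unᵍ-reach (reach-step r ed) with unᵍ-reach r
  ... | inj₁ refl with unSucc-∈ u ed
  ...   | refl = inj₂ (root g , refl , reach-root)
  unᵍ-reach (reach-step r ed) | inj₂ (a , refl , ra) with edge-ι⁻ unᵍ-embedding ed
  ...   | b , refl , ed′ = inj₂ (b , refl , reach-step ra ed′)

  unᵍ-isCyclic : IsCyclicFormula g → IsCyclicFormula (unᵍ u g)
  unᵍ-isCyclic cyclic {t = t} r walk back unique with unᵍ-reach r
  ... | inj₁ refl = ⊥-elim (unᵍ-root-source {t} back)
  ... | inj₂ (a , refl , ra) = cycle-ι⁻ unᵍ-embedding cyclic ra walk back unique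

module _ (b : BinOp) (g h : Graph) where

  binᵍ-embeddingˡ : Embedding g (binᵍ b g h)
  binᵍ-embeddingˡ = record
    { ι = λ a → suc (a ↑ˡ size h)
    ; injective = λ {a} {a′} eq → ↑ˡ-injective (size h) a a′ (suc-injective eq)
    ; label-ι = label-ι′
    ; edge-ι⁻ = edge
    }
    where
    label-ι′ : ∀ a → label (binᵍ b g h) (suc (a ↑ˡ size h)) ≡ label g a
    label-ι′ a rewrite splitAt-↑ˡ (size g) a (size h) = refl
    edge : ∀ {a w} → Edge (binᵍ b g h) (suc (a ↑ˡ size h)) w →
           ∃ λ a′ → w ≡ suc (a′ ↑ˡ size h) × Edge g a a′
    edge {a} ed with splitAt (size g) (a ↑ˡ size h) | splitAt-↑ˡ (size g) a (size h)
    ... | _ | refl with ∈ᵛ-map⁻ _ ed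
    ... | a′ , ed′ , refl = a′ , refl , ed′

  binᵍ-embeddingʳ : Embedding h (binᵍ b g h)
  binᵍ-embeddingʳ = record
    { ι = λ c → suc (size g ↑ʳ c)
    ; injective = λ {c} {c′} eq → ↑ʳ-injective (size g) c c′ (suc-injective eq)
    ; label-ι = label-ι′
    ; edge-ι⁻ = edge
    }
    where
    label-ι′ : ∀ c → label (binᵍ b g h) (suc (size g ↑ʳ c)) ≡ label h c
    label-ι′ c rewrite splitAt-↑ʳ (size g) (size h) c = refl
    edge : ∀ {c w} → Edge (binᵍ b g h) (suc (size g ↑ʳ c)) w →
           ∃ λ c′ → w ≡ suc (size g ↑ʳ c′) × Edge h c c′
    edge {c} ed with splitAt (size g) (size g ↑ʳ c) | splitAt-↑ʳ (size g) (size h) c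
    ... | _ | refl with ∈ᵛ-map⁻ _ ed
    ... | c′ , ed′ , refl = c′ , refl , ed′

  binᵍ-root-source : ∀ {t} → ¬ Edge (binᵍ b g h) t zero
  binᵍ-root-source {zero} ed with binSucc-∈ b ed
  ... | inj₁ ()
  ... | inj₂ ()
  binᵍ-root-source {suc t} ed with splitAt (size g) t
  ... | inj₁ a with ∈ᵛ-map⁻ _ ed
  ...   | _ , _ , ()
  binᵍ-root-source {suc t} ed | inj₂ c with ∈ᵛ-map⁻ _ ed
  ...   | _ , _ , ()

  binᵍ-reach : ∀ {v} → Reach (binᵍ b g h) v →
    v ≡ zero ⊎ (∃ λ a → v ≡ ι binᵍ-embeddingˡ a × Reach g a)
             ⊎ (∃ λ c → v ≡ ι binᵍ-embeddingʳ c × Reach h c)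
  binᵍ-reach reach-root = inj₁ refl
  binᵍ-reach (reach-step r ed) with binᵍ-reach r
  ... | inj₁ refl with binSucc-∈ b ed
  ...   | inj₁ refl = inj₂ (inj₁ (root g , refl , reach-root))
  ...   | inj₂ refl = inj₂ (inj₂ (root h , refl , reach-root))
  binᵍ-reach (reach-step r ed) | inj₂ (inj₁ (a , refl , ra)) with edge-ι⁻ binᵍ-embeddingˡ {a} ed
  ...   | a′ , refl , ed′ = inj₂ (inj₁ (a′ , refl , reach-step ra ed′))
  binᵍ-reach (reach-step r ed) | inj₂ (inj₂ (c , refl , rc)) with edge-ι⁻ binᵍ-embeddingʳ {c} ed
  ...   | c′ , refl , ed′ = inj₂ (inj₂ (c′ , refl , reach-step rc ed′))

  binᵍ-isCyclic : IsCyclicFormula g → IsCyclicFormula h → IsCyclicFormula (binᵍ b g h)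
  binᵍ-isCyclic cyclic-g cyclic-h {t = t} r walk back unique with binᵍ-reach r
  ... | inj₁ refl = ⊥-elim (binᵍ-root-source {t} back)
  ... | inj₂ (inj₁ (a , refl , ra)) = cycle-ι⁻ binᵍ-embeddingˡ cyclic-g ra walk back unique
  ... | inj₂ (inj₂ (c , refl , rc)) = cycle-ι⁻ binᵍ-embeddingʳ cyclic-h rc walk back unique

≤max : ∀ {A : Set} (f : A → ℕ) {xs : List A} {x} → x ∈ˡ xs → f x ≤ foldr _⊔_ 0 (List.map f xs)
≤max f {y ∷ _} (here refl) = m≤m⊔n (f y) _
≤max f {y ∷ _} (there x∈) = m≤n⇒m≤o⊔n (f y) (≤max f x∈)

<⇒≡ᵇ-false : ∀ {q p} → q < p → (q ≡ᵇ p) ≡ false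
<⇒≡ᵇ-false {zero} {suc p} _ = refl
<⇒≡ᵇ-false {suc q} {suc p} (s≤s q<p) = <⇒≡ᵇ-false q<p

isVar-varIdx : ∀ p l → varIdx l < p → isVar p l ≡ false
isVar-varIdx p ⊥ᴸ _ = refl
isVar-varIdx p ⊤ᴸ _ = refl
isVar-varIdx p (varᴸ q) q<p = <⇒≡ᵇ-false q<p
isVar-varIdx p ¬ᴸ _ = refl
isVar-varIdx p □ᴸ _ = refl
isVar-varIdx p ∧ᴸ _ = refl
isVar-varIdx p ∨ᴸ _ = refl
isVar-varIdx p →ᴸ _ = refl

isVar-fresh : ∀ g a → isVar (fresh g) (label g a) ≡ false
isVar-fresh g a = isVar-varIdx (fresh g) (label g a) (s≤s (≤max (varIdx ∘ label g) (∈-allFin a)))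

isVar-refl : ∀ p → isVar p (varᴸ p) ≡ true
isVar-refl p = Equivalence.to Bool.T-≡ (≡⇒≡ᵇ p p refl)

redirect : ℕ → (G : Graph) → Fin (size G) → Fin (size G)
redirect p G w = if isVar p (label G w) then root G else w

redirect-ι : ∀ {g G} p (E : Embedding g G) → (∀ a → isVar p (label g a) ≡ false) →
             ∀ b → redirect p G (ι E b) ≡ ι E b
redirect-ι p E p∉g b rewrite label-ι E b | p∉g b = refl

ϝ-embedding : ∀ {g G} p → (E : Embedding g G) → (∀ a → isVar p (label g a) ≡ false) →
              Embedding g (ϝ p G)
ϝ-embedding {g} {G} p E p∉g = record
  { ι = ι E ; injective = injective E ; label-ι = label-ι E ; edge-ι⁻ = edge }
  where
  edge : ∀ {a w} → Edge (ϝ p G) (ι E a) w → ∃ λ b → w ≡ ι E b × Edge g a b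
  edge ed with ∈ᵛ-map⁻ (redirect p G) ed
  ... | w′ , ed′ , refl with edge-ι⁻ E ed′
  ... | b , refl , ed″ = b , redirect-ι p E p∉g b , ed″

Folds : ∀ {m n} → (Fin n → Fin m) → Fin m → Fin n → Set
Folds f b y = f y ≡ b

IsHomomorphism : (h g : Graph) → (Fin (size h) → Fin (size g)) → Set
IsHomomorphism h g f = f (root h) ≡ root g ×
  (∀ y → label g (f y) ≡ label h y × Pointwise (Folds f) (succ g (f y)) (succ h y))

homomorphism-≃ : ∀ {g h} f → IsHomomorphism h g f → g ≃ h
homomorphism-≃ {g} {h} f (f-root , f-hom) = Folds f , bisimulation , f-root
  where
  bisimulation : IsBisimulation g h (Folds f)
  bisimulation {a' = y} refl = f-hom y

module Fixpoint (g : Graph) where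

  p : ℕ
  p = fresh g

  B : Graph
  B = □• g

  inner : Embedding g (□ᵍ (g ∧ᵍ varᵍ p))
  inner = unᵍ-embedding boxOp _ ∘ᴱ binᵍ-embeddingˡ andOp g (varᵍ p)

  embedding : Embedding g B
  embedding = ϝ-embedding p inner (isVar-fresh g)

  ιB : Fin (size g) → Fin (size B)
  ιB = ι embedding

  variable-vertex : Fin (size B)
  variable-vertex = suc (suc (size g ↑ʳ zero))

  redirect-variable : redirect p B variable-vertex ≡ zero
  redirect-variable rewrite splitAt-↑ʳ (size g) 1 zero | isVar-refl p = refl

  redirect-ιB : ∀ a → redirect p B (ιB a) ≡ ιB a
  redirect-ιB = redirect-ι p inner (isVar-fresh g)

  edge-root : ∀ {w} → Edge B zero w → w ≡ suc zero
  edge-root (VecAny.here refl) = refl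

  edge-∧ : ∀ {w} → Edge B (suc zero) w → w ≡ ιB (root g) ⊎ w ≡ zero
  edge-∧ (VecAny.here refl) = inj₁ (redirect-ιB (root g))
  edge-∧ (VecAny.there (VecAny.here refl)) = inj₂ redirect-variable

  reach : ∀ {v} → Reach B v → v ≡ zero ⊎ v ≡ suc zero ⊎ ∃ λ a → v ≡ ιB a × Reach g a
  reach reach-root = inj₁ refl
  reach (reach-step r ed) with reach r
  ... | inj₁ refl with edge-root ed
  ...   | refl = inj₂ (inj₁ refl)
  reach (reach-step r ed) | inj₂ (inj₁ refl) with edge-∧ ed
  ...   | inj₁ refl = inj₂ (inj₂ (root g , refl , reach-root))
  ...   | inj₂ refl = inj₁ refl
  reach (reach-step r ed) | inj₂ (inj₂ (a , refl , ra)) with edge-ι⁻ embedding {a} ed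
  ...   | b , refl , ed′ = inj₂ (inj₂ (b , refl , reach-step ra ed′))

  -- A cycle through the root contains the root's □; one through the ∧-vertex
  -- either returns to the root or enters the copy of g, which it never leaves.
  isCyclic : IsCyclicFormula g → IsCyclicFormula B
  isCyclic cyclic r walk back unique with reach r
  ... | inj₁ refl = walk-start walk refl
  ... | inj₂ (inj₂ (a , refl , ra)) = cycle-ι⁻ embedding cyclic ra walk back unique
  isCyclic cyclic r here back unique | inj₂ (inj₁ refl) with edge-∧ back
  ... | inj₁ ()
  ... | inj₂ ()
  isCyclic cyclic r (there ed walk) back unique | inj₂ (inj₁ refl) with edge-∧ ed
  ... | inj₂ refl = there (walk-start walk refl)
  ... | inj₁ refl with walk-ι⁻ embedding {root g} walk
  ...   | t′ , _ , _ , refl , refl with edge-ι⁻ embedding {t′} back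
  ...     | _ , () , _

  unfolded : Graph
  unfolded = □ᵍ (g ∧ᵍ B)

  -- Sends the copy of g in □(g ∧ □•g) to the copy of g inside □•g, and the
  -- copy of □•g to □•g itself.
  fold : Fin (size unfolded) → Fin (size B)
  fold zero = zero
  fold (suc zero) = suc zero
  fold (suc (suc j)) = [ ιB , id ]′ (splitAt (size g) j)

  fold-ι : ∀ a → fold (suc (suc (a ↑ˡ size B))) ≡ redirect p B (ιB a)
  fold-ι a rewrite splitAt-↑ˡ (size g) a (size B) = sym (redirect-ιB a)

  fold-copy : ∀ b → fold (suc (suc (size g ↑ʳ b))) ≡ b
  fold-copy b rewrite splitAt-↑ʳ (size g) (size B) b = refl

  fold-succ-ι : ∀ {n} (xs : Vec (Fin (size g)) n) → Pointwise (Folds fold)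
    (Vec.map (redirect p B) (Vec.map suc (Vec.map (λ x → suc (x ↑ˡ 1)) xs)))
    (Vec.map suc (Vec.map (λ x → suc (x ↑ˡ size B)) xs))
  fold-succ-ι [] = []
  fold-succ-ι (x ∷ xs) = fold-ι x ∷ fold-succ-ι xs

  fold-succ-copy : ∀ {n} (xs : Vec (Fin (size B)) n) → Pointwise (Folds fold)
    xs (Vec.map suc (Vec.map (λ x → suc (size g ↑ʳ x)) xs))
  fold-succ-copy [] = []
  fold-succ-copy (x ∷ xs) = fold-copy x ∷ fold-succ-copy xs

  fold-isHomomorphism : IsHomomorphism unfolded B fold
  fold-isHomomorphism = refl , hom
    where
    hom : ∀ y → label B (fold y) ≡ label unfolded y ×
          Pointwise (Folds fold) (succ B (fold y)) (succ unfolded y)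
    hom zero = refl , refl ∷ []
    hom (suc zero) = refl , fold-ι (root g) ∷ trans (fold-copy zero) (sym redirect-variable) ∷ []
    hom (suc (suc j)) with splitAt (size g) j
    ... | inj₂ b = refl , fold-succ-copy (succ B b)
    ... | inj₁ a with splitAt (size g) (a ↑ˡ 1) | splitAt-↑ˡ (size g) a 1
    ...   | _ | refl = refl , fold-succ-ι (succ g a)

  unfold-≃ : B ≃ unfolded
  unfold-≃ = homomorphism-≃ fold fold-isHomomorphism

⊥ᵍ-isCyclic : IsCyclicFormula ⊥ᵍ
⊥ᵍ-isCyclic _ _ () _

⊥F ⊤F : Formula
⊥F = formula ⊥ᵍ ⊥ᵍ-isCyclic
⊤F = formula ⊤ᵍ ⊤ᵍ-isCyclic

¬F_ □F_ : Formula → Formula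
¬F A = formula (¬ᵍ gr A) (unᵍ-isCyclic negOp (gr A) (isFormula A))
□F A = formula (□ᵍ gr A) (unᵍ-isCyclic boxOp (gr A) (isFormula A))

_∧F_ _∨F_ _⇒F_ : Formula → Formula → Formula
A ∧F B = formula (gr A ∧ᵍ gr B) (binᵍ-isCyclic andOp (gr A) (gr B) (isFormula A) (isFormula B))
A ∨F B = formula (gr A ∨ᵍ gr B) (binᵍ-isCyclic orOp (gr A) (gr B) (isFormula A) (isFormula B))
A ⇒F B = formula (gr A ⇒ᵍ gr B) (binᵍ-isCyclic impOp (gr A) (gr B) (isFormula A) (isFormula B))

□•F_ ⊡•F_ : Formula → Formula
□•F A = formula (□• gr A) (Fixpoint.isCyclic (gr A) (isFormula A))
⊡•F A = A ∧F □•F A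

infix 30 ¬F_ □F_ □•F_ ⊡•F_
infixr 25 _∧F_
infixr 24 _∨F_
infixr 23 _⇒F_

⋀F : List Formula → Formula
⋀F [] = ⊤F
⋀F (A ∷ As) = A ∧F ⋀F As

⋀-map-gr : ∀ As → ⋀ (List.map gr As) ≡ gr (⋀F As)
⋀-map-gr [] = refl
⋀-map-gr (A ∷ As) = cong (gr A ∧ᵍ_) (⋀-map-gr As)

instF : (ℕ → Formula) → PForm → Formula
instF σ (pvar i) = σ i
instF σ p⊥ = ⊥F
instF σ p⊤ = ⊤F
instF σ (p¬ A) = ¬F instF σ A
instF σ (p∧ A B) = instF σ A ∧F instF σ B
instF σ (p∨ A B) = instF σ A ∨F instF σ B
instF σ (p⇒ A B) = instF σ A ⇒F instF σ B

gr-instF : ∀ σ A → gr (instF σ A) ≡ inst (gr ∘ σ) A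
gr-instF σ (pvar i) = refl
gr-instF σ p⊥ = refl
gr-instF σ p⊤ = refl
gr-instF σ (p¬ A) = cong ¬ᵍ_ (gr-instF σ A)
gr-instF σ (p∧ A B) = cong₂ _∧ᵍ_ (gr-instF σ A) (gr-instF σ B)
gr-instF σ (p∨ A B) = cong₂ _∨ᵍ_ (gr-instF σ A) (gr-instF σ B)
gr-instF σ (p⇒ A B) = cong₂ _⇒ᵍ_ (gr-instF σ A) (gr-instF σ B)

-- Unlike CHL⊢ gr A, this type determines A, so formulas are inferable from derivations.
record ⊢ᶠ_ (A : Formula) : Set₁ where
  constructor derive
  field derivation : CHL⊢ gr A

open ⊢ᶠ_

infix 10 ⊢ᶠ_

_·_ : ∀ {A B} → ⊢ᶠ A ⇒F B → ⊢ᶠ A → ⊢ᶠ B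
derive a⇒b · derive a = derive (mp a a⇒b)

infixl 5 _·_

necᶠ : ∀ {A} → ⊢ᶠ A → ⊢ᶠ □F A
necᶠ (derive a) = derive (nec a)

löbᶠ : ∀ {A} → ⊢ᶠ □F A ⇒F A → ⊢ᶠ A
löbᶠ (derive □a⇒a) = derive (löb □a⇒a)

axKᶠ : ∀ A B → ⊢ᶠ □F (A ⇒F B) ⇒F □F A ⇒F □F B
axKᶠ A B = derive (axK A B)

_⇒ᵖ_ _∧ᵖ_ : PForm → PForm → PForm
_⇒ᵖ_ = p⇒
_∧ᵖ_ = p∧

infixr 6 _⇒ᵖ_
infixr 7 _∧ᵖ_

x₀ x₁ x₂ x₃ x₄ : PForm
x₀ = pvar 0
x₁ = pvar 1
x₂ = pvar 2
x₃ = pvar 3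
x₄ = pvar 4

assignment : List Formula → ℕ → Formula
assignment [] _ = ⊤F
assignment (A ∷ As) zero = A
assignment (A ∷ As) (suc i) = assignment As i

tautology : ∀ A {_ : True (truthTable? A)} As → ⊢ᶠ instF (assignment As) A
tautology A {rows} As = derive (subst CHL⊢_ (sym (gr-instF (assignment As) A))
  (taut A (truthTable⇒tautology A (toWitness rows)) (assignment As)))

∧-projˡ : ∀ A B → ⊢ᶠ A ∧F B ⇒F A
∧-projˡ A B = tautology (x₀ ∧ᵖ x₁ ⇒ᵖ x₀) (A ∷ B ∷ [])

∧-projʳ : ∀ A B → ⊢ᶠ A ∧F B ⇒F B
∧-projʳ A B = tautology (x₀ ∧ᵖ x₁ ⇒ᵖ x₁) (A ∷ B ∷ [])

⇒-trans : ∀ {A B C} → ⊢ᶠ A ⇒F B → ⊢ᶠ B ⇒F C → ⊢ᶠ A ⇒F C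
⇒-trans {A} {B} {C} A⇒B B⇒C =
  tautology ((x₀ ⇒ᵖ x₁) ⇒ᵖ (x₁ ⇒ᵖ x₂) ⇒ᵖ x₀ ⇒ᵖ x₂) (A ∷ B ∷ C ∷ []) · A⇒B · B⇒C

□-mono : ∀ {A B} → ⊢ᶠ A ⇒F B → ⊢ᶠ □F A ⇒F □F B
□-mono {A} {B} A⇒B = axKᶠ A B · necᶠ A⇒B

□-∧ : ∀ A B → ⊢ᶠ □F A ⇒F □F B ⇒F □F (A ∧F B)
□-∧ A B = ⇒-trans (□-mono (tautology (x₀ ⇒ᵖ x₁ ⇒ᵖ x₀ ∧ᵖ x₁) (A ∷ B ∷ []))) (axKᶠ B (A ∧F B))

□•-unfold : ∀ A → ⊢ᶠ □•F A ⇒F □F (A ∧F □•F A)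
□•-unfold A = ∧-projˡ (□•F A ⇒F □F (A ∧F □•F A)) (□F (A ∧F □•F A) ⇒F □•F A)
              · derive (bisim (□•F A) (□F (A ∧F □•F A)) (Fixpoint.unfold-≃ (gr A)))

-- Persistent formulas

Persistent : Formula → Set₁
Persistent A = ⊢ᶠ A ⇒F □F A

⊤-persistent : Persistent ⊤F
⊤-persistent = tautology (x₀ ⇒ᵖ x₁ ⇒ᵖ x₀) (□F ⊤F ∷ ⊤F ∷ []) · necᶠ (tautology p⊤ [])

∧-persistent : ∀ {A B} → Persistent A → Persistent B → Persistent (A ∧F B)
∧-persistent {A} {B} A⇒□A B⇒□B =
  tautology ((x₀ ⇒ᵖ x₂) ⇒ᵖ (x₁ ⇒ᵖ x₃) ⇒ᵖ (x₂ ⇒ᵖ x₃ ⇒ᵖ x₄) ⇒ᵖ x₀ ∧ᵖ x₁ ⇒ᵖ x₄)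
            (A ∷ B ∷ □F A ∷ □F B ∷ □F (A ∧F B) ∷ [])
  · A⇒□A · B⇒□B · □-∧ A B

⋀-persistent : ∀ {As} → All Persistent As → Persistent (⋀F As)
⋀-persistent [] = ⊤-persistent
⋀-persistent (A⇒□A ∷ persistent) = ∧-persistent A⇒□A (⋀-persistent persistent)

□•-persistent : ∀ A → Persistent (□•F A)
□•-persistent A = ⇒-trans (□•-unfold A) (□-mono (∧-projʳ A (□•F A)))

⊡•-persistent : ∀ A → Persistent (⊡•F A)
⊡•-persistent A = ⇒-trans (∧-projʳ A (□•F A)) (□•-unfold A)

-- K turns □(G → φ) into □G → □φ, so for persistent G, Löb's rule applies under G.

löb-persistent : ∀ {G φ} → Persistent G → ⊢ᶠ G ⇒F □F φ ⇒F φ → ⊢ᶠ G ⇒F φ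
löb-persistent {G} {φ} G⇒□G G⇒löb = löbᶠ
  (tautology ((x₀ ⇒ᵖ x₁ ⇒ᵖ x₂) ⇒ᵖ (x₃ ⇒ᵖ x₁) ⇒ᵖ (x₃ ⇒ᵖ x₂ ⇒ᵖ x₄) ⇒ᵖ x₀ ⇒ᵖ x₃ ⇒ᵖ x₄)
             (□F (G ⇒F φ) ∷ □F G ∷ □F φ ∷ G ∷ φ ∷ [])
   · axKᶠ G φ · G⇒□G · G⇒löb)

ctxF : ∀ {n m} → (Fin n → Formula) → (Fin m → Formula) → List Formula
ctxF ψ χ = List.tabulate (□•F_ ∘ ψ) ++ List.tabulate (⊡•F_ ∘ χ)

⋀ctx≡⋀ctxF : ∀ {n m} (ψ : Fin n → Formula) (χ : Fin m → Formula) →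
             ⋀ (ctx ψ χ) ≡ gr (⋀F (ctxF ψ χ))
⋀ctx≡⋀ctxF ψ χ = begin
  ⋀ (ctx ψ χ)                ≡⟨ cong ⋀ (sym map-gr-ctxF) ⟩
  ⋀ (List.map gr (ctxF ψ χ)) ≡⟨ ⋀-map-gr (ctxF ψ χ) ⟩
  gr (⋀F (ctxF ψ χ))         ∎
  where
  open ≡-Reasoning
  map-gr-ctxF : List.map gr (ctxF ψ χ) ≡ ctx ψ χ
  map-gr-ctxF = trans (map-++ gr (List.tabulate (□•F_ ∘ ψ)) (List.tabulate (⊡•F_ ∘ χ)))
                      (cong₂ _++_ (map-tabulate (□•F_ ∘ ψ) gr) (map-tabulate (⊡•F_ ∘ χ) gr))

ctxF-persistent : ∀ {n m} (ψ : Fin n → Formula) (χ : Fin m → Formula) →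
                  Persistent (⋀F (ctxF ψ χ))
ctxF-persistent ψ χ = ⋀-persistent (All.++⁺ (All.tabulate⁺ (□•-persistent ∘ ψ))
                                            (All.tabulate⁺ (⊡•-persistent ∘ χ)))

corollary3p5 : (n m : ℕ) (ψ : Fin n → Formula) (χ : Fin m → Formula) (φ : Formula) →
    ctx ψ χ ⊢ (□ᵍ gr φ ⇒ᵍ gr φ) → ctx ψ χ ⊢ gr φ
corollary3p5 n m ψ χ φ hyp = subst (λ Γ → CHL⊢ Γ ⇒ᵍ gr φ) (sym ⋀Γ≡G) (derivation G⇒φ)
  where
  G : Formula
  G = ⋀F (ctxF ψ χ)
  ⋀Γ≡G : ⋀ (ctx ψ χ) ≡ gr G
  ⋀Γ≡G = ⋀ctx≡⋀ctxF ψ χ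
  G⇒löb : ⊢ᶠ G ⇒F □F φ ⇒F φ
  G⇒löb = derive (subst (λ Γ → CHL⊢ Γ ⇒ᵍ □ᵍ gr φ ⇒ᵍ gr φ) ⋀Γ≡G hyp)
  G⇒φ : ⊢ᶠ G ⇒F φ
  G⇒φ = löb-persistent (ctxF-persistent ψ χ) G⇒löb
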